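{- Fix constants $c>0$, $\gamma\in(0,1)$, let $f$ be a linear objective function with $n=n(f)\ge2$, and consider one iteration (step $t+1$) of the (1+1) EA with mutation rate $p_n$ from a current solution $x[t]$. Let $i$ be a bit position with $x_i[t]=1$ contained in some block $B$, and suppose there is a block $L$ immediately to the left of $B$. Then the events $I_i[t+1]$ and $A_{t+1}$ together imply the event $I'_{\ell_L}[t+1]$.
   Context: $f(x)=\sum_{i=1}^na_ix_i$ on $x=x_n\ldots x_1\in\{0,1\}^n$ with $0<a_1\le\cdots\le a_n$; position $n$ is leftmost, $1$ rightmost. Miniblocks: start with $j=1$. If $a_n/a_j<n^2$, then $\{j,\ldots,n\}$ is a miniblock and we stop. Otherwise let $i$ be the least element of $\{j+1,\ldots,n\}$ with $a_i/a_j\ge n^2$; then $\{j,\ldots,i\}$ is a miniblock; if $i=n$ stop, else set $j=i$ and repeat. Blocks: going through the miniblocks from right to left, each consecutive pair of miniblocks is united into a block. A block is long if it has at least $\gamma n$ positions, short otherwise. While two long blocks are separated by at most two short blocks, they are merged with the short blocks in between into one long block, until any two long blocks have at least three short blocks between them. $\ell_B$, $r_B$ are the leftmost (largest) and rightmost (smallest) positions of block $B$. One EA iteration: a mutation mask $y[t+1]\in\{0,1\}^n$ has independent bits equal to $1$ with probability $p_n$; $x'[t+1]=x[t]\oplus y[t+1]$ (bitwise XOR). $A_{t+1}$ is the event $\sum_ja_jx'_j[t+1]\le\sum_ja_jx_j[t]$ (mutation accepted). $I_i[t+1]$ is the event that $y_i[t+1]=1$ and $y_j[t+1]=0$ for every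 $j>i$ with $x_j[t]=1$. $I'_\ell[t+1]$ is the event that $y_j[t+1]=0$ for every $j>\ell$ with $x_j[t]=0$.
   Formalization: The coefficients $a_i$ of f and the constants γ and c take rational values. -}

module Defs where

open import Data.Bool using (Bool; true; false; if_then_else_; _xor_; not; _∧_)
open import Data.Nat as ℕ using (ℕ; zero; suc; _∸_)
open import Data.Integer using (+_)
open import Data.Rational using (ℚ; _/_; _+_; _*_; _≤ᵇ_; 0ℚ; _≤_)
open import Data.List using (List; []; _∷_; map; upTo; length)
open import Data.Maybe using (Maybe; just; nothing)
import Data.Maybe
open import Relation.Nullary using (yes; no)
open import Data.Product using (_×_; _,_; proj₁; proj₂; ∃₂)
open import Data.List using (_++_)
open import Relation.Binary.PropositionalEquality using (_≡_)

-- Conventions: positions are 1..n (position n leftmost/most significant).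
-- Weights and bit strings are functions on ℕ; only positions 1..n are ever used.

⟦_⟧ : ℕ → ℚ
⟦ k ⟧ = + k / 1

bit : Bool → ℚ
bit true  = ⟦ 1 ⟧
bit false = 0ℚ

fval : (a : ℕ → ℚ) (x : ℕ → Bool) → ℕ → ℚ
fval a x zero    = 0ℚ
fval a x (suc k) = fval a x k + a (suc k) * bit (x (suc k))

-- bitwise XOR (the offspring x' = x ⊕ y)
_⊕_ : (ℕ → Bool) → (ℕ → Bool) → (ℕ → Bool)
(x ⊕ y) k = x k xor y k

findFirst : (ℕ → Bool) → List ℕ → Maybe ℕ
findFirst p []       = nothing
findFirst p (k ∷ ks) = if p k then just k else findFirst p ks

-- least i ∈ {j+1,…,n} with a_i / a_j ≥ n², i.e. n²·a_j ≤ a_i (a_j > 0)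
nextBd : (n : ℕ) (a : ℕ → ℚ) (j : ℕ) → Maybe ℕ
nextBd n a j = findFirst (λ i → (⟦ n ℕ.* n ⟧ * a j) ≤ᵇ a i)
                         (map (λ d → suc j ℕ.+ d) (upTo (n ∸ j)))

-- miniblocks as intervals (r , ℓ) = {r,…,ℓ}, listed from right to left,
-- starting at j (fuel bounds the number of steps; n steps always suffice)
miniFrom : (n : ℕ) (a : ℕ → ℚ) (fuel j : ℕ) → List (ℕ × ℕ)
miniFrom n a zero       j = (j , n) ∷ []
miniFrom n a (suc fuel) j with nextBd n a j
... | nothing = (j , n) ∷ []
... | just i  with i ℕ.≟ n
...   | yes _ = (j , n) ∷ []
...   | no _  = (j , i) ∷ miniFrom n a fuel i

miniblocks : (n : ℕ) (a : ℕ → ℚ) → List (ℕ × ℕ)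
miniblocks n a = miniFrom n a n 1

pairUp : List (ℕ × ℕ) → List (ℕ × ℕ)
pairUp []                        = []
pairUp (m ∷ [])                  = m ∷ []
pairUp ((r , _) ∷ (_ , l) ∷ ms)  = (r , l) ∷ pairUp ms

size : ℕ × ℕ → ℕ
size (r , l) = suc (l ∸ r)

isLong : (γ : ℚ) (n : ℕ) → ℕ × ℕ → Bool
isLong γ n b = (γ * ⟦ n ⟧) ≤ᵇ ⟦ size b ⟧

join : ℕ × ℕ → ℕ × ℕ → ℕ × ℕ
join (r , _) (_ , l) = (r , l)

scanLong : (ℕ × ℕ → Bool) → ℕ → List (ℕ × ℕ) → Maybe ((ℕ × ℕ) × List (ℕ × ℕ))
scanLong lg zero    _          = nothing
scanLong lg (suc k) []         = nothing
scanLong lg (suc k) (c ∷ rest) = if lg c then just (c , rest) else scanLong lg k rest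

-- perform one merge (at the rightmost opportunity) of two long blocks
-- separated by at most two short blocks, if any such pair exists
mergeStep : (ℕ × ℕ → Bool) → List (ℕ × ℕ) → Maybe (List (ℕ × ℕ))
mergeStep lg [] = nothing
mergeStep lg (b ∷ bs) with lg b | scanLong lg 3 bs
... | true | just (c , rest) = just (join b c ∷ rest)
... | _    | _               = Data.Maybe.map (b ∷_) (mergeStep lg bs)

-- repeat merging until no two long blocks are separated by ≤ 2 short blocks
-- (each merge shortens the list, so fuel = length suffices)
mergeAll : (ℕ × ℕ → Bool) → ℕ → List (ℕ × ℕ) → List (ℕ × ℕ)
mergeAll lg zero       bs = bs
mergeAll lg (suc fuel) bs with mergeStep lg bs
... | nothing  = bs
... | just bs' = mergeAll lg fuel bs'

blocks : (γ : ℚ) (n : ℕ) (a : ℕ → ℚ) → List (ℕ × ℕ)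
blocks γ n a = mergeAll (isLong γ n) (length pb) pb
  where pb = pairUp (miniblocks n a)

-- B and L are consecutive blocks, L immediately to the left of B
-- (blocks are listed from right to left)
ImmediatelyLeft : (L B : ℕ × ℕ) → List (ℕ × ℕ) → Set
ImmediatelyLeft L B bs = ∃₂ λ pre post → bs ≡ pre ++ B ∷ L ∷ post

Accepted : (n : ℕ) (a : ℕ → ℚ) (x y : ℕ → Bool) → Set
Accepted n a x y = fval a (x ⊕ y) n ≤ fval a x n

EventI : (n : ℕ) (x y : ℕ → Bool) (i : ℕ) → Set
EventI n x y i = (y i ≡ true) × (∀ j → i ℕ.< j → j ℕ.≤ n → x j ≡ true → y j ≡ false)

EventI' : (n : ℕ) (x y : ℕ → Bool) (l : ℕ) → Set
EventI' n x y l = ∀ j → l ℕ.< j → j ℕ.≤ n → x j ≡ false → y j ≡ false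

module Submission where

-- Suppose the mutation turns a zero at some position j > ℓ_L into a one. Under I_i no one-bit
-- above i is flipped, so above i the offspring only gains, and position j alone gains a_j; at
-- positions ≤ i it loses at most i·a_i. Acceptance thus forces a_j ≤ i·a_i. But i ≤ ℓ_B ≤ r_L,
-- and every block that is not the leftmost ends at a miniblock boundary, so every weight left of
-- L is at least n²·a_{r_L} ≥ n²·a_i > i·a_i.

open import Defs
open import Data.Bool using (Bool; true)
open import Data.Nat using (ℕ; suc) renaming (_≤_ to _≤ₙ_; _<_ to _<ₙ_)
open import Data.Rational using (ℚ; 0ℚ; 1ℚ; _≤_; _<_)
open import Data.Product using (_×_; proj₁; proj₂)
open import Relation.Binary.PropositionalEquality using (_≡_)

open import Algebra using (CommutativeMonoid)
open import Data.Bool using (false; T)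
open import Data.Empty using (⊥-elim)
import Data.Integer as ℤ
import Data.Integer.Properties as ℤₚ
open import Data.List using (List; []; _∷_; _++_; map; upTo; length)
open import Data.List.Membership.Propositional using (_∈_)
open import Data.List.Membership.Propositional.Properties using (∈-map⁻; ∈-upTo⁻)
open import Data.List.Relation.Unary.Any using (here; there)
open import Data.Maybe using (just; nothing)
open import Data.Nat using (zero; z≤n; s≤s)
import Data.Nat as ℕ
import Data.Nat.Properties as ℕₚ
open import Data.Nat.Coprimality using (1-coprimeTo) renaming (sym to coprime-sym)
open import Data.Product using (_,_)
open import Data.Rational using (mkℚ; _≤ᵇ_; _+_; _*_; -_; _/_; *<*; positive)
open import Data.Rational.Properties
open import Data.Sum using (inj₁; inj₂)
open import Relation.Nullary using (yes; no)
open import Relation.Binary.PropositionalEquality using (refl; sym; trans; cong; subst; subst₂)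

open import Algebra.Properties.CommutativeSemigroup
  (CommutativeMonoid.commutativeSemigroup +-0-commutativeMonoid) using (xy∙z≈xz∙y)
open import Algebra.Properties.Group +-0-group using (//-rightDividesʳ)

⟦⟧≡mkℚ : ∀ k → ⟦ k ⟧ ≡ mkℚ (ℤ.+ k) 0 (coprime-sym (1-coprimeTo k))
⟦⟧≡mkℚ k = normalize-coprime (coprime-sym (1-coprimeTo k))

-- After the rewrite, ⟦ k ⟧ + 1ℚ computes to ((+ ◃ k ℕ.* 1) ℤ.+ + 1) / 1.
⟦suc⟧ : ∀ k → ⟦ suc k ⟧ ≡ ⟦ k ⟧ + 1ℚ
⟦suc⟧ k rewrite ⟦⟧≡mkℚ k =
  cong (λ z → z / 1) (sym (trans (cong (ℤ._+ ℤ.+ 1) (trans (ℤₚ.+◃n≡+n (k ℕ.* 1)) (cong ℤ.+_ (ℕₚ.*-identityʳ k))))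
                                  (cong ℤ.+_ (ℕₚ.+-comm k 1))))

⟦⟧-mono-< : ∀ {m k} → m <ₙ k → ⟦ m ⟧ < ⟦ k ⟧
⟦⟧-mono-< {m} {k} m<k rewrite ⟦⟧≡mkℚ m | ⟦⟧≡mkℚ k = *<* (ℤₚ.*-monoʳ-<-pos (ℤ.+ 1) (ℤ.+<+ m<k))

+-cancelʳ-≤ : ∀ r {p q} → p + r ≤ q + r → p ≤ q
+-cancelʳ-≤ r {p} {q} h = subst₂ _≤_ (//-rightDividesʳ r p) (//-rightDividesʳ r q) (+-monoˡ-≤ (- r) h)

*-bit-nonneg : ∀ {A} b → 0ℚ ≤ A → 0ℚ ≤ A * bit b
*-bit-nonneg {A} true 0≤A = subst (0ℚ ≤_) (sym (*-identityʳ A)) 0≤A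
*-bit-nonneg {A} false _ = ≤-reflexive (sym (*-zeroʳ A))

*-bit≤ : ∀ {A w} b → 0ℚ ≤ w → A ≤ w → A * bit b ≤ w
*-bit≤ {A} {w} true  _   A≤w = subst (_≤ w) (sym (*-identityʳ A)) A≤w
*-bit≤ {A} {w} false 0≤w _   = subst (_≤ w) (sym (*-zeroʳ A)) 0≤w

*-bit-mono : ∀ {A b c} → 0ℚ ≤ A → (b ≡ true → c ≡ true) → A * bit b ≤ A * bit c
*-bit-mono {b = true}  _ b⇒c rewrite b⇒c refl = ≤-refl
*-bit-mono {A} {false} {c} 0≤A _ = subst (_≤ A * bit c) (sym (*-zeroʳ A)) (*-bit-nonneg c 0≤A)

NondecreasingOn : ℕ → (ℕ → ℚ) → Set
NondecreasingOn n a = ∀ {u v} → 1 ≤ₙ u → u ≤ₙ v → v ≤ₙ n → a u ≤ a v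

stepwise⇒nondecreasingOn : ∀ {n a} → (∀ k → 1 ≤ₙ k → k <ₙ n → a k ≤ a (suc k)) → NondecreasingOn n a
stepwise⇒nondecreasingOn step {u} {zero} 1≤u u≤0 _ = ⊥-elim (ℕₚ.<⇒≱ 1≤u u≤0)
stepwise⇒nondecreasingOn step {u} {suc v} 1≤u u≤v+1 v<n with ℕₚ.m≤n⇒m<n∨m≡n u≤v+1
... | inj₂ refl = ≤-refl
... | inj₁ (s≤s u≤v) =
  ≤-trans (stepwise⇒nondecreasingOn step 1≤u u≤v (ℕₚ.<⇒≤ v<n)) (step v (ℕₚ.≤-trans 1≤u u≤v) v<n)

fval-nonneg : ∀ {a} u m → (∀ {k} → 1 ≤ₙ k → k ≤ₙ m → 0ℚ ≤ a k) → 0ℚ ≤ fval a u m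
fval-nonneg u zero    _      = ≤-refl
fval-nonneg u (suc m) a≥0 =
  +-mono-≤ (fval-nonneg u m λ 1≤k k≤m → a≥0 1≤k (ℕₚ.m≤n⇒m≤1+n k≤m))
           (*-bit-nonneg (u (suc m)) (a≥0 (s≤s z≤n) ℕₚ.≤-refl))

fval≤ : ∀ {a w} u m → 0ℚ ≤ w → (∀ {k} → 1 ≤ₙ k → k ≤ₙ m → a k ≤ w) → fval a u m ≤ ⟦ m ⟧ * w
fval≤ {w = w} u zero    _   _   = ≤-reflexive (sym (*-zeroˡ w))
fval≤ {a} {w} u (suc m) 0≤w a≤w = begin
  fval a u m + a (suc m) * bit (u (suc m)) ≤⟨ +-mono-≤ (fval≤ u m 0≤w λ 1≤k k≤m → a≤w 1≤k (ℕₚ.m≤n⇒m≤1+n k≤m))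
                                                       (*-bit≤ (u (suc m)) 0≤w (a≤w (s≤s z≤n) ℕₚ.≤-refl)) ⟩
  ⟦ m ⟧ * w + w                            ≡⟨ cong ((⟦ m ⟧ * w) +_) (sym (*-identityˡ w)) ⟩
  ⟦ m ⟧ * w + 1ℚ * w                       ≡⟨ sym (*-distribʳ-+ w ⟦ m ⟧ 1ℚ) ⟩
  (⟦ m ⟧ + 1ℚ) * w                         ≡⟨ cong (_* w) (sym (⟦suc⟧ m)) ⟩
  ⟦ suc m ⟧ * w                            ∎
  where open ≤-Reasoning

DominatesAbove : ℕ → ℕ → (ℕ → Bool) → (ℕ → Bool) → Set
DominatesAbove n p u v = ∀ k → p <ₙ k → k ≤ₙ n → u k ≡ true → v k ≡ true

module _ {n : ℕ} {a : ℕ → ℚ} (a-mono : NondecreasingOn n a) (0≤a₁ : 0ℚ ≤ a 1) where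

  a-nonneg : ∀ {k} → 1 ≤ₙ k → k ≤ₙ n → 0ℚ ≤ a k
  a-nonneg 1≤k k≤n = ≤-trans 0≤a₁ (a-mono ℕₚ.≤-refl 1≤k k≤n)

  -- Above p, v has a one wherever u has, so dropping the top position costs v at least as much as u.
  deficit-prefix : ∀ {u v p m} s → DominatesAbove n p u v → p ≤ₙ m → m ≤ₙ n →
                   fval a v m + s ≤ fval a u m → fval a v p + s ≤ fval a u p
  deficit-prefix s dom p≤m m≤n deficit with ℕₚ.m≤n⇒m<n∨m≡n p≤m
  ... | inj₂ refl = deficit
  deficit-prefix {u} {v} {m = suc m} s dom _ m<n deficit | inj₁ (s≤s p≤m) =
    deficit-prefix s dom p≤m (ℕₚ.<⇒≤ m<n) (+-cancelʳ-≤ (A * bit (v (suc m))) (begin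
      fval a v m + s + A * bit (v (suc m))  ≡⟨ xy∙z≈xz∙y (fval a v m) s _ ⟩
      fval a v (suc m) + s                  ≤⟨ deficit ⟩
      fval a u m + A * bit (u (suc m))      ≤⟨ +-monoʳ-≤ (fval a u m) (*-bit-mono (a-nonneg (s≤s z≤n) m<n)
                                                                                (dom (suc m) (s≤s p≤m) m<n)) ⟩
      fval a u m + A * bit (v (suc m))      ∎))
    where
    open ≤-Reasoning
    A : ℚ
    A = a (suc m)

  accepted⇒flip-weight≤ : ∀ {u v i j} → fval a v n ≤ fval a u n → DominatesAbove n i u v →
                          1 ≤ₙ i → i <ₙ j → j ≤ₙ n → u j ≡ false → v j ≡ true → a j ≤ ⟦ i ⟧ * a i
  accepted⇒flip-weight≤ {u} {v} {i} {suc j₀} accepted dom 1≤i (s≤s i≤j₀) j≤n uj vj = begin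
    a j                  ≡⟨ sym (+-identityˡ (a j)) ⟩
    0ℚ + a j             ≤⟨ +-monoˡ-≤ (a j) (fval-nonneg v i λ 1≤k k≤i → a-nonneg 1≤k (ℕₚ.≤-trans k≤i i≤n)) ⟩
    fval a v i + a j     ≤⟨ deficit-prefix (a j) dom i≤j₀ (ℕₚ.<⇒≤ j≤n) gain-below-j ⟩
    fval a u i           ≤⟨ fval≤ u i (a-nonneg 1≤i i≤n) (λ 1≤k k≤i → a-mono 1≤k k≤i i≤n) ⟩
    ⟦ i ⟧ * a i          ∎
    where
    open ≤-Reasoning
    j : ℕ
    j = suc j₀
    i≤n : i ≤ₙ n
    i≤n = ℕₚ.≤-trans i≤j₀ (ℕₚ.<⇒≤ j≤n)
    gain-below-j : fval a v j₀ + a j ≤ fval a u j₀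
    gain-below-j = begin
      fval a v j₀ + a j                ≡⟨ cong (_+_ (fval a v j₀)) (sym (*-identityʳ (a j))) ⟩
      fval a v j₀ + a j * bit true     ≡⟨ cong (λ b → fval a v j₀ + a j * bit b) (sym vj) ⟩
      fval a v j                       ≡⟨ sym (+-identityʳ _) ⟩
      fval a v j + 0ℚ                  ≤⟨ deficit-prefix 0ℚ (λ k j<k → dom k (ℕₚ.<-trans (s≤s i≤j₀) j<k)) j≤n ℕₚ.≤-refl
                                            (subst (_≤ fval a u n) (sym (+-identityʳ _)) accepted) ⟩
      fval a u j                       ≡⟨ cong (λ b → fval a u j₀ + a j * bit b) uj ⟩
      fval a u j₀ + a j * bit false    ≡⟨ trans (cong (_+_ (fval a u j₀)) (*-zeroʳ (a j))) (+-identityʳ _) ⟩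
      fval a u j₀                      ∎

findFirst-just : ∀ p xs {i} → findFirst p xs ≡ just i → i ∈ xs × T (p i)
findFirst-just p (k ∷ ks) eq with p k in pk
... | true  with refl ← eq = here refl , subst T (sym pk) _
... | false with i∈ks , pi ← findFirst-just p ks eq = there i∈ks , pi

module _ (n : ℕ) (a : ℕ → ℚ) where

  WellSeparated : ℕ × ℕ → Set
  WellSeparated (r , l) = r ≤ₙ l × (∀ k → l <ₙ k → k ≤ₙ n → ⟦ n ℕ.* n ⟧ * a r ≤ a k)

  data Ordered : ℕ → List (ℕ × ℕ) → Set where
    []   : ∀ {lo} → Ordered lo []
    cons : ∀ {lo r l bs} → lo ≤ₙ r → WellSeparated (r , l) → Ordered l bs → Ordered lo ((r , l) ∷ bs)

  ordered-weaken : ∀ {lo′ lo bs} → lo′ ≤ₙ lo → Ordered lo bs → Ordered lo′ bs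
  ordered-weaken _      []                  = []
  ordered-weaken lo′≤lo (cons lo≤r sep ord) = cons (ℕₚ.≤-trans lo′≤lo lo≤r) sep ord

  join-wellSeparated : ∀ {r m r′ l} → WellSeparated (r , m) → m ≤ₙ r′ → WellSeparated (r′ , l) →
                       WellSeparated (r , l)
  join-wellSeparated {m = m} {l = l} (r≤m , heavy) m≤r′ (r′≤l , _) =
    ℕₚ.≤-trans r≤m m≤l , λ k l<k → heavy k (ℕₚ.≤-<-trans m≤l l<k)
    where
    m≤l : m ≤ₙ l
    m≤l = ℕₚ.≤-trans m≤r′ r′≤l

  last-wellSeparated : ∀ {r} → r ≤ₙ n → WellSeparated (r , n)
  last-wellSeparated r≤n = r≤n , λ k n<k k≤n → ⊥-elim (ℕₚ.<⇒≱ n<k k≤n)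

  pairUp-ordered : ∀ {lo bs} → Ordered lo bs → Ordered lo (pairUp bs)
  pairUp-ordered []                                    = []
  pairUp-ordered (cons lo≤r sep [])                    = cons lo≤r sep []
  pairUp-ordered (cons lo≤r sep (cons m≤r′ sep′ ord)) =
    cons lo≤r (join-wellSeparated sep m≤r′ sep′) (pairUp-ordered ord)

  scanLong-ordered : ∀ lg k {lo bs c rest} → Ordered lo bs → scanLong lg k bs ≡ just (c , rest) →
                     Ordered lo (c ∷ rest)
  scanLong-ordered lg (suc k) {bs = (r , l) ∷ _} (cons lo≤r sep ord) eq with lg (r , l)
  ... | true  with refl ← eq = cons lo≤r sep ord
  ... | false = ordered-weaken (ℕₚ.≤-trans lo≤r (proj₁ sep)) (scanLong-ordered lg k ord eq)

  mergeStep-ordered : ∀ lg {lo bs bs′} → Ordered lo bs → mergeStep lg bs ≡ just bs′ → Ordered lo bs′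
  mergeStep-ordered lg {bs = (r , l) ∷ bs} (cons lo≤r sep ord) eq
    with lg (r , l) | scanLong lg 3 bs in scan
  ... | true | just (c , rest) with refl ← eq with scanLong-ordered lg 3 ord scan
  ...   | cons l≤r′ sep′ ord′ = cons lo≤r (join-wellSeparated sep l≤r′ sep′) ord′
  mergeStep-ordered lg {bs = _ ∷ bs} (cons lo≤r sep ord) eq | true | nothing with mergeStep lg bs in step
  ... | just _ with refl ← eq = cons lo≤r sep (mergeStep-ordered lg ord step)
  mergeStep-ordered lg {bs = _ ∷ bs} (cons lo≤r sep ord) eq | false | _ with mergeStep lg bs in step
  ... | just _ with refl ← eq = cons lo≤r sep (mergeStep-ordered lg ord step)

  mergeAll-ordered : ∀ lg fuel {lo bs} → Ordered lo bs → Ordered lo (mergeAll lg fuel bs)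
  mergeAll-ordered lg zero       ord = ord
  mergeAll-ordered lg (suc fuel) {bs = bs} ord with mergeStep lg bs in step
  ... | nothing  = ord
  ... | just bs′ = mergeAll-ordered lg fuel (mergeStep-ordered lg ord step)

  nextBd-just : ∀ {j i} → j ≤ₙ n → nextBd n a j ≡ just i → j <ₙ i × i ≤ₙ n × ⟦ n ℕ.* n ⟧ * a j ≤ a i
  nextBd-just {j} j≤n eq
    with findFirst-just (λ i → ⟦ n ℕ.* n ⟧ * a j ≤ᵇ a i) (map (λ d → suc j ℕ.+ d) (upTo (n ℕ.∸ j))) eq
  ... | i∈ , ratio with ∈-map⁻ (λ d → suc j ℕ.+ d) i∈
  ...   | d , d∈ , refl =
    s≤s (ℕₚ.m≤m+n j d) ,
    subst (suc j ℕ.+ d ≤ₙ_) (ℕₚ.m+[n∸m]≡n j≤n) (ℕₚ.+-monoʳ-< j (∈-upTo⁻ d∈)) ,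
    ≤ᵇ⇒≤ ratio

  miniFrom-ordered : NondecreasingOn n a → ∀ fuel {lo j} → lo ≤ₙ j → 1 ≤ₙ j → j ≤ₙ n →
                     Ordered lo (miniFrom n a fuel j)
  miniFrom-ordered a-mono zero lo≤j _ j≤n = cons lo≤j (last-wellSeparated j≤n) []
  miniFrom-ordered a-mono (suc fuel) {j = j} lo≤j 1≤j j≤n with nextBd n a j in next
  ... | nothing = cons lo≤j (last-wellSeparated j≤n) []
  ... | just i with i ℕ.≟ n
  ...   | yes _ = cons lo≤j (last-wellSeparated j≤n) []
  ...   | no _ with nextBd-just j≤n next
  ...     | j<i , i≤n , ratio =
    cons lo≤j (ℕₚ.<⇒≤ j<i , λ k i<k k≤n → ≤-trans ratio (a-mono 1≤i (ℕₚ.<⇒≤ i<k) k≤n))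
         (miniFrom-ordered a-mono fuel ℕₚ.≤-refl 1≤i i≤n)
    where
    1≤i : 1 ≤ₙ i
    1≤i = ℕₚ.≤-trans 1≤j (ℕₚ.<⇒≤ j<i)

  blocks-ordered : NondecreasingOn n a → ∀ γ → 1 ≤ₙ n → Ordered 1 (blocks γ n a)
  blocks-ordered a-mono γ 1≤n =
    mergeAll-ordered (isLong γ n) (length (pairUp (miniblocks n a)))
      (pairUp-ordered (miniFrom-ordered a-mono n ℕₚ.≤-refl ℕₚ.≤-refl 1≤n))

  ordered-adjacent : ∀ {lo B L bs} → Ordered lo bs → ImmediatelyLeft L B bs →
                     proj₂ B ≤ₙ proj₁ L × WellSeparated L
  ordered-adjacent {B = B} {L} ord (pre , post , refl) = go pre ord
    where
    go : ∀ {lo} pre → Ordered lo (pre ++ B ∷ L ∷ post) → proj₂ B ≤ₙ proj₁ L × WellSeparated L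
    go []        (cons _ _ (cons lB≤rL sepL _)) = lB≤rL , sepL
    go (_ ∷ pre) (cons _ _ ord)                  = go pre ord

lemma8 : (c γ : ℚ) → 0ℚ < c → 0ℚ < γ → γ < 1ℚ →
    (n : ℕ) → 2 ≤ₙ n →
    (a : ℕ → ℚ) → 0ℚ < a 1 → (∀ k → 1 ≤ₙ k → k <ₙ n → a k ≤ a (suc k)) →
    (x y : ℕ → Bool) →
    (i : ℕ) → 1 ≤ₙ i → i ≤ₙ n → x i ≡ true →
    (B L : ℕ × ℕ) → ImmediatelyLeft L B (blocks γ n a) →
    proj₁ B ≤ₙ i → i ≤ₙ proj₂ B →
    EventI n x y i → Accepted n a x y →
    EventI' n x y (proj₂ L)
lemma8 _ γ _ _ _ n 2≤n a 0<a₁ step x y i 1≤i i≤n _ (_ , lB) (rL , lL) adjacent _ i≤lB (_ , keepsOnes) accepted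
  j lL<j j≤n xj with y j in yj
... | false = refl
... | true  = ⊥-elim (<-irrefl refl (begin-strict
  a j                   ≤⟨ accepted⇒flip-weight≤ a-mono (<⇒≤ 0<a₁) accepted dominates 1≤i i<j j≤n xj flipped ⟩
  ⟦ i ⟧ * a i           <⟨ *-monoˡ-<-pos (a i) {{positive 0<aᵢ}} (⟦⟧-mono-< i<n²) ⟩
  ⟦ n ℕ.* n ⟧ * a i     ≤⟨ *-monoˡ-≤-nonNeg ⟦ n ℕ.* n ⟧ {{normalize-nonNeg (n ℕ.* n) 1}} (a-mono 1≤i i≤rL rL≤n) ⟩
  ⟦ n ℕ.* n ⟧ * a rL    ≤⟨ heavy j lL<j j≤n ⟩
  a j                   ∎))
  where
  open ≤-Reasoning
  a-mono : NondecreasingOn n a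
  a-mono = stepwise⇒nondecreasingOn step
  1≤n : 1 ≤ₙ n
  1≤n = ℕₚ.≤-trans (s≤s z≤n) 2≤n
  separation : lB ≤ₙ rL × WellSeparated n a (rL , lL)
  separation = ordered-adjacent n a (blocks-ordered n a a-mono γ 1≤n) adjacent
  rL≤lL : rL ≤ₙ lL
  rL≤lL = proj₁ (proj₂ separation)
  heavy : ∀ k → lL <ₙ k → k ≤ₙ n → ⟦ n ℕ.* n ⟧ * a rL ≤ a k
  heavy = proj₂ (proj₂ separation)
  i≤rL : i ≤ₙ rL
  i≤rL = ℕₚ.≤-trans i≤lB (proj₁ separation)
  i<j : i <ₙ j
  i<j = ℕₚ.≤-<-trans (ℕₚ.≤-trans i≤rL rL≤lL) lL<j
  rL≤n : rL ≤ₙ n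
  rL≤n = ℕₚ.≤-trans rL≤lL (ℕₚ.<⇒≤ (ℕₚ.<-≤-trans lL<j j≤n))
  0<aᵢ : 0ℚ < a i
  0<aᵢ = <-≤-trans 0<a₁ (a-mono ℕₚ.≤-refl 1≤i i≤n)
  i<n² : i <ₙ n ℕ.* n
  i<n² = ℕₚ.≤-<-trans i≤n (ℕₚ.m<m*n n n {{ℕ.>-nonZero 1≤n}} 2≤n)
  dominates : DominatesAbove n i x (x ⊕ y)
  dominates k i<k k≤n xk rewrite xk | keepsOnes k i<k k≤n xk = refl
  flipped : (x ⊕ y) j ≡ true
  flipped rewrite xj | yj = refl
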